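{- Let $G$ be a degenerate 3-connected graph which is not 3-regular, and let $u\in V(G)$ with $\deg_G(u)=3$, with neighbours $v_1,v_2,v_3$. (a) If $\deg_G(v_i)\ge 4$ for all $i\in\{1,2,3\}$, set $G':=G-u$. (b) If $\deg_G(v_1)=3$ and $\deg_G(v_3)\ge 4$, set $G':=G-u+v_1v_2$. Then $G'$ is critical 2.5-connected and $|V(G')|<|V(G)|$.
   Context: Graphs are finite, may have parallel edges, and have no loops. A graph is biconnected if it is connected and for every triple of distinct vertices $u,v,w$ there is a $u$-$v$-path avoiding $w$. For a biconnected graph $G$ that is not a triangle, $(c,e)\in V(G)\times E(G)$ is a vertex-edge-separator if $G-e-c$ is disconnected; $G$ is 2.5-connected if it is biconnected and has no vertex-edge-separator. A vertex-2-edge-separator of a biconnected graph $G$ is a triple $(c,e_1,e_2)\in V(G)\times E(G)^2$ with $G-e_1-e_2-c$ disconnected. $G$ is critical 2.5-connected if it is 2.5-connected and $G-e$ is not 2.5-connected for every $e\in E(G)$. If $u\in V(G)$ has degree $3$ with incident edges $e_0,e_1,e_2$ and $c$ is the other end of $e_0$, then $(c,e_1,e_2)$ is a degenerate vertex-2-edge-separator. A critical 2.5-connected graph is degenerate if every vertex-2-edge-separator of it is degenerate. -}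

module Defs where

open import Data.Nat using (ℕ; zero; suc; pred; _+_; _≤_; _<_)
open import Data.Fin using (Fin; zero; suc; punchOut)
open import Data.Fin.Properties using (_≟_)
open import Data.List using (List; []; _∷_; length; lookup)
open import Data.List.Membership.Propositional using (_∈_)
open import Data.Product using (Σ; _×_; _,_; proj₁; proj₂)
open import Data.Sum using (_⊎_)
open import Data.Bool using (Bool; true; false; if_then_else_; _∨_)
open import Relation.Nullary using (¬_; yes; no; does)
open import Relation.Binary.PropositionalEquality using (_≡_; _≢_)
open import Data.Unit using (⊤)

-- A (multi)graph on the vertex set Fin n: a list of edges (parallel edges allowed).
-- Edge e of G is an index e : Fin (length G).
Graph : ℕ → Set
Graph n = List (Fin n × Fin n)

Edge : ∀ {n} → Graph n → Set
Edge G = Fin (length G)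

Loopless : ∀ {n} → Graph n → Set
Loopless {n} G = (e : Edge G) → proj₁ (lookup G e) ≢ proj₂ (lookup G e)

Adj : ∀ {n} → Graph n → Fin n → Fin n → Set
Adj G x y = ((x , y) ∈ G) ⊎ ((y , x) ∈ G)

Inc : ∀ {n} (G : Graph n) → Fin n → Edge G → Set
Inc G x e = (x ≡ proj₁ (lookup G e)) ⊎ (x ≡ proj₂ (lookup G e))

-- degree (number of incident edges; graphs are loopless)
deg : ∀ {n} → Graph n → Fin n → ℕ
deg [] x = 0
deg ((a , b) ∷ es) x = (if does (x ≟ a) ∨ does (x ≟ b) then 1 else 0) + deg es x

-- walks all of whose vertices satisfy P (existence equivalent to paths)
data Reach {n} (G : Graph n) (P : Fin n → Set) : Fin n → Fin n → Set where
  stop : ∀ {x} → P x → Reach G P x x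
  step : ∀ {x y z} → P x → Adj G x y → Reach G P y z → Reach G P x z

Connected : ∀ {n} → Graph n → Set
Connected {n} G = (x y : Fin n) → Reach G (λ _ → ⊤) x y

dropWhere : ∀ {A : Set} (xs : List A) → (Fin (length xs) → Bool) → List A
dropWhere [] f = []
dropWhere (x ∷ xs) f =
  if f zero then dropWhere xs (λ i → f (suc i)) else x ∷ dropWhere xs (λ i → f (suc i))

deleteEdge : ∀ {n} (G : Graph n) → Edge G → Graph n
deleteEdge G e = dropWhere G (λ i → does (i ≟ e))

deleteEdge2 : ∀ {n} (G : Graph n) → Edge G → Edge G → Graph n
deleteEdge2 G e₁ e₂ = dropWhere G (λ i → does (i ≟ e₁) ∨ does (i ≟ e₂))

-- G - c : delete vertex c and its incident edges, renumbering vertices via punchOut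
deleteVertex : ∀ {n} → Graph n → Fin n → Graph (pred n)
deleteVertex {suc n} [] c = []
deleteVertex {suc n} ((a , b) ∷ es) c with c ≟ a | c ≟ b
... | no p | no q = (punchOut p , punchOut q) ∷ deleteVertex es c
... | _    | _    = deleteVertex es c

addEdge : ∀ {n} → Graph n → Fin n → Fin n → Graph n
addEdge G x y = (x , y) ∷ G

Biconnected : ∀ {n} → Graph n → Set
Biconnected {n} G =
  Connected G ×
  ((u v w : Fin n) → u ≢ v → v ≢ w → u ≢ w → Reach G (λ z → z ≢ w) u v)

IsTriangle : ∀ {n} → Graph n → Set
IsTriangle {n} G = (n ≡ 3) × (length G ≡ 3) × ((x y : Fin n) → x ≢ y → Adj G x y)

VertexEdgeSeparator : ∀ {n} (G : Graph n) → Fin n → Edge G → Set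
VertexEdgeSeparator G c e = ¬ Connected (deleteVertex (deleteEdge G e) c)

TwoFiveConnected : ∀ {n} → Graph n → Set
TwoFiveConnected {n} G =
  Biconnected G ×
  (¬ IsTriangle G → ¬ Σ (Fin n) (λ c → Σ (Edge G) (λ e → VertexEdgeSeparator G c e)))

Critical25 : ∀ {n} → Graph n → Set
Critical25 G = TwoFiveConnected G × ((e : Edge G) → ¬ TwoFiveConnected (deleteEdge G e))

Vertex2EdgeSeparator : ∀ {n} (G : Graph n) → Fin n → Edge G → Edge G → Set
Vertex2EdgeSeparator G c e₁ e₂ = ¬ Connected (deleteVertex (deleteEdge2 G e₁ e₂) c)

DegenerateSep : ∀ {n} (G : Graph n) → Fin n → Edge G → Edge G → Set
DegenerateSep {n} G c e₁ e₂ =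
  Σ (Fin n) λ u → Σ (Edge G) λ e₀ →
    (deg G u ≡ 3) × (e₀ ≢ e₁) × (e₀ ≢ e₂) × (e₁ ≢ e₂) ×
    Inc G u e₁ × Inc G u e₂ ×
    ((lookup G e₀ ≡ (u , c)) ⊎ (lookup G e₀ ≡ (c , u)))

Degenerate : ∀ {n} → Graph n → Set
Degenerate {n} G =
  Critical25 G ×
  ((c : Fin n) (e₁ e₂ : Edge G) → Vertex2EdgeSeparator G c e₁ e₂ → DegenerateSep G c e₁ e₂)

ThreeConnected : ∀ {n} → Graph n → Set
ThreeConnected {n} G =
  (4 ≤ n) × Connected G ×
  ((a b x y : Fin n) → x ≢ a → x ≢ b → y ≢ a → y ≢ b →
     Reach G (λ z → (z ≢ a) × (z ≢ b)) x y)

ThreeRegular : ∀ {n} → Graph n → Set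
ThreeRegular {n} G = (x : Fin n) → deg G x ≡ 3

module Submission where

-- * G' is biconnected: by 3-connectivity of G, any two vertices of G - u are joined by
--   a walk avoiding u and any further prescribed vertex.
-- * G' has no vertex-edge-separator (c,e).  In G, (c,e) is no separator (G is
--   2.5-connected), and for every v_k of degree ≠ 3 neither is (c,e,f_k), since all
--   vertex-2-edge-separators of G are degenerate.  A walk of G - e - c that passes
--   through u enters and leaves u at neighbours v_k, v_l; the second fact yields
--   detours v_k → v_l avoiding u (in case b the new edge v₁v₂ supplies the missing
--   one), so every such walk can be rerouted inside G' - e - c.
-- * G' is critical: as G is critical and degenerate, every edge of G has an end of
--   degree 3 (edge-has-degree3-end); that end keeps degree 3 in G', and deleting an
--   edge at a degree-3 vertex always creates a vertex-edge-separator
--   (deg3-edge-deletion-separates).  G' - e is no triangle because G has at least five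
--   vertices: in case a, u, its neighbours and the degree-3 end are distinct; in case b
--   a four-vertex G would force v₂ to have degree 3 and four edges at once.

open import Defs
open import Data.Nat using (ℕ; zero; suc; _+_; _≤_; _<_; z≤n; s≤s)
open import Data.Nat.Properties
  using (≤-trans; ≤-refl; ≤-reflexive; ≤-antisym; <⇒≱; m≤n⇒m≤1+n; +-suc; +-identityʳ;
         +-comm; +-assoc; +-cancelˡ-≡; n<1+n)
import Data.Nat.Properties as ℕ
open import Algebra.Properties.CommutativeSemigroup ℕ.+-commutativeSemigroup using (x∙yz≈y∙xz)
open import Data.Fin using (Fin; zero; suc; punchOut; punchIn)
open import Data.Fin.Properties
  using (_≟_; any?; 0≢1+n; punchIn-punchOut; punchInᵢ≢i; punchIn-injective; suc-injective)
open import Data.List using (List; []; _∷_; length; lookup)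
open import Data.List.Relation.Unary.Any using (index)
open import Data.List.Relation.Unary.Any.Properties using (lookup-index)
open import Data.List.Membership.Propositional using (_∈_)
open import Data.List.Membership.Propositional.Properties using (∈-lookup)
open import Data.List.Relation.Unary.All as All using (All; []; _∷_)
open import Data.List.Relation.Unary.AllPairs using ([]; _∷_)
open import Data.List.Relation.Unary.Unique.Propositional using (Unique)
open import Data.Product using (Σ; _×_; _,_; proj₁; proj₂)
open import Data.Sum using (_⊎_; inj₁; inj₂)
open import Data.Bool using (Bool; true; false; if_then_else_; _∨_; _∧_)
open import Data.Bool.Properties using (∨-conicalˡ; ∨-conicalʳ)
open import Data.Empty using (⊥; ⊥-elim)
open import Function using (_∘_)
open import Data.Unit using (⊤; tt)
open import Relation.Nullary using (¬_; yes; no; does; Dec)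
open import Relation.Nullary.Decidable using (dec-true; dec-false)
open import Relation.Binary.PropositionalEquality
  using (_≡_; _≢_; refl; sym; trans; cong; cong₂; subst; subst₂; module ≡-Reasoning)

data Joins {n} (H : Graph n) (i : Edge H) (x y : Fin n) : Set where
  fwd : lookup H i ≡ (x , y) → Joins H i x y
  bwd : lookup H i ≡ (y , x) → Joins H i x y

joins-sym : ∀ {n} {H : Graph n} {i x y} → Joins H i x y → Joins H i y x
joins-sym (fwd p) = bwd p
joins-sym (bwd p) = fwd p

-- Walks of H from x to y all of whose edges satisfy Q and all of whose vertices
-- satisfy P.  Unlike Reach, they record the edges used, which is what edge deletion needs.
data Walk {n} (H : Graph n) (Q : Edge H → Set) (P : Fin n → Set) : Fin n → Fin n → Set where
  done : ∀ {x} → P x → Walk H Q P x x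
  hop  : ∀ {x y z} → P x → (i : Edge H) → Q i → Joins H i x y → Walk H Q P y z → Walk H Q P x z

module _ {n} {H : Graph n} {Q : Edge H → Set} {P : Fin n → Set} where
  walk-head : ∀ {x y} → Walk H Q P x y → P x
  walk-head (done p) = p
  walk-head (hop p _ _ _ _) = p

  walk-last : ∀ {x y} → Walk H Q P x y → P y
  walk-last (done p) = p
  walk-last (hop _ _ _ _ w) = walk-last w

  walk-cat : ∀ {x y z} → Walk H Q P x y → Walk H Q P y z → Walk H Q P x z
  walk-cat (done _) w = w
  walk-cat (hop p i q j w) w' = hop p i q j (walk-cat w w')

  walk-rev : ∀ {x y} → Walk H Q P x y → Walk H Q P y x
  walk-rev (done p) = done p
  walk-rev (hop p i q j w) = walk-cat (walk-rev w) (hop (walk-head w) i q (joins-sym j) (done p))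

walk-map : ∀ {n} {H₁ H₂ : Graph n} {Q₁ Q₂ P₁ P₂} →
  (∀ {x y} i → P₁ x → P₁ y → Q₁ i → Joins H₁ i x y → Σ (Edge H₂) λ j → Q₂ j × Joins H₂ j x y) →
  (∀ {x} → P₁ x → P₂ x) → ∀ {x y} → Walk H₁ Q₁ P₁ x y → Walk H₂ Q₂ P₂ x y
walk-map f g (done p) = done (g p)
walk-map f g (hop p i q j w) with f i p (walk-head w) q j
... | k , q' , j' = hop (g p) k q' j' (walk-map f g w)

walk-weaken : ∀ {n} {H : Graph n} {Q₁ Q₂ : Edge H → Set} {P₁ P₂ : Fin n → Set} →
  (∀ i → Q₁ i → Q₂ i) → (∀ {x} → P₁ x → P₂ x) → ∀ {x y} → Walk H Q₁ P₁ x y → Walk H Q₂ P₂ x y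
walk-weaken f g = walk-map (λ i _ _ q j → i , f i q , j) g

adj→joins : ∀ {n} {H : Graph n} {x y} → Adj H x y → Σ (Edge H) λ i → Joins H i x y
adj→joins (inj₁ m) = index m , fwd (sym (lookup-index m))
adj→joins (inj₂ m) = index m , bwd (sym (lookup-index m))

joins→adj : ∀ {n} {H : Graph n} {i x y} → Joins H i x y → Adj H x y
joins→adj {H = H} {i} (fwd e) = inj₁ (subst (_∈ H) e (∈-lookup i))
joins→adj {H = H} {i} (bwd e) = inj₂ (subst (_∈ H) e (∈-lookup i))

reach→walk : ∀ {n} {H : Graph n} {P x y} → Reach H P x y → Walk H (λ _ → ⊤) P x y
reach→walk (stop p) = done p
reach→walk (step p a r) with adj→joins a
... | i , j = hop p i tt j (reach→walk r)

walk→reach : ∀ {n} {H : Graph n} {Q P x y} → Walk H Q P x y → Reach H P x y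
walk→reach (done p) = stop p
walk→reach (hop p i q j w) = step p (joins→adj j) (walk→reach w)

first-step : ∀ {n} {H : Graph n} {Q P x y} → Walk H Q P x y → x ≢ y →
  Σ (Edge H) λ j → Σ (Fin n) λ z → Q j × Joins H j x z × P z
first-step (done p) ne = ⊥-elim (ne refl)
first-step (hop p i q j w) ne = i , _ , q , j , walk-head w

joins-inc₁ : ∀ {n} {H : Graph n} {i x y} → Joins H i x y → Inc H x i
joins-inc₁ (fwd e) = inj₁ (sym (cong proj₁ e))
joins-inc₁ (bwd e) = inj₂ (sym (cong proj₂ e))

joins-inc₂ : ∀ {n} {H : Graph n} {i x y} → Joins H i x y → Inc H y i
joins-inc₂ j = joins-inc₁ (joins-sym j)

joins-ends : ∀ {n} {H : Graph n} {i x y z} → Joins H i x y → Inc H z i → z ≡ x ⊎ z ≡ y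
joins-ends (fwd e) (inj₁ f) = inj₁ (trans f (cong proj₁ e))
joins-ends (fwd e) (inj₂ f) = inj₂ (trans f (cong proj₂ e))
joins-ends (bwd e) (inj₁ f) = inj₂ (trans f (cong proj₁ e))
joins-ends (bwd e) (inj₂ f) = inj₁ (trans f (cong proj₂ e))

inc→joins : ∀ {n} {H : Graph n} {x i} → Inc H x i → Σ (Fin n) λ y → Joins H i x y
inc→joins {H = H} {i = i} (inj₁ e) = proj₂ (lookup H i) , fwd (cong (_, proj₂ (lookup H i)) (sym e))
inc→joins {H = H} {i = i} (inj₂ e) = proj₁ (lookup H i) , bwd (cong (proj₁ (lookup H i) ,_) (sym e))

joins-distinct : ∀ {n} {H : Graph n} → Loopless H → ∀ {i x y} → Joins H i x y → x ≢ y
joins-distinct ll {i} (fwd e) xy = ll i (trans (cong proj₁ e) (trans xy (sym (cong proj₂ e))))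
joins-distinct ll {i} (bwd e) xy = ll i (trans (cong proj₁ e) (trans (sym xy) (sym (cong proj₂ e))))

joins-other-end : ∀ {n} {H : Graph n} → Loopless H → ∀ {i x y z} → Joins H i x y → Joins H i x z → y ≡ z
joins-other-end ll j₁ j₂ with joins-ends j₁ (joins-inc₂ j₂)
... | inj₂ e = sym e
... | inj₁ e = ⊥-elim (joins-distinct ll j₂ (sym e))

distinct-edges : ∀ {n} {H : Graph n} → Loopless H → ∀ {i j x a b} →
  Joins H i x a → Joins H j x b → a ≢ b → i ≢ j
distinct-edges ll j₁ j₂ ab refl = ab (joins-other-end ll j₁ j₂)

-- Edge deletion.  dropWhere xs f keeps the entries not flagged by f; kept xs f j is the
-- position in xs of its j-th entry.  kept is an injective enumeration of the unflagged
-- positions, and it preserves entries.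
kept : ∀ {A : Set} (xs : List A) (f : Fin (length xs) → Bool) →
  Fin (length (dropWhere xs f)) → Fin (length xs)
kept (x ∷ xs) f j with f zero
... | true = suc (kept xs (λ i → f (suc i)) j)
kept (x ∷ xs) f zero | false = zero
kept (x ∷ xs) f (suc j) | false = suc (kept xs (λ i → f (suc i)) j)

kept-lookup : ∀ {A : Set} (xs : List A) (f : Fin (length xs) → Bool) j →
  lookup (dropWhere xs f) j ≡ lookup xs (kept xs f j)
kept-lookup (x ∷ xs) f j with f zero
... | true = kept-lookup xs (λ i → f (suc i)) j
kept-lookup (x ∷ xs) f zero | false = refl
kept-lookup (x ∷ xs) f (suc j) | false = kept-lookup xs (λ i → f (suc i)) j

kept-unflagged : ∀ {A : Set} (xs : List A) (f : Fin (length xs) → Bool) j → f (kept xs f j) ≡ false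
kept-unflagged (x ∷ xs) f j with f zero in eq
... | true = kept-unflagged xs (λ i → f (suc i)) j
kept-unflagged (x ∷ xs) f zero | false = eq
kept-unflagged (x ∷ xs) f (suc j) | false = kept-unflagged xs (λ i → f (suc i)) j

kept-onto : ∀ {A : Set} (xs : List A) (f : Fin (length xs) → Bool) i → f i ≡ false →
  Σ (Fin (length (dropWhere xs f))) λ j → kept xs f j ≡ i
kept-onto (x ∷ xs) f i e with f zero in eq
kept-onto (x ∷ xs) f zero e | true with () ← trans (sym eq) e
kept-onto (x ∷ xs) f (suc i) e | true with kept-onto xs (λ i → f (suc i)) i e
... | j , p = j , cong suc p
kept-onto (x ∷ xs) f zero e | false = zero , refl
kept-onto (x ∷ xs) f (suc i) e | false with kept-onto xs (λ i → f (suc i)) i e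
... | j , p = suc j , cong suc p

kept-injective : ∀ {A : Set} (xs : List A) (f : Fin (length xs) → Bool) j₁ j₂ →
  kept xs f j₁ ≡ kept xs f j₂ → j₁ ≡ j₂
kept-injective (x ∷ xs) f j₁ j₂ e with f zero
... | true = kept-injective xs (λ i → f (suc i)) j₁ j₂ (suc-injective e)
kept-injective (x ∷ xs) f zero zero e | false = refl
kept-injective (x ∷ xs) f (suc j₁) (suc j₂) e | false =
  cong suc (kept-injective xs (λ i → f (suc i)) j₁ j₂ (suc-injective e))

joins-kept : ∀ {n} (H : Graph n) (f : Edge H → Bool) j {x y} → Joins (dropWhere H f) j x y → Joins H (kept H f j) x y
joins-kept H f j (fwd e) = fwd (trans (sym (kept-lookup H f j)) e)
joins-kept H f j (bwd e) = bwd (trans (sym (kept-lookup H f j)) e)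

walk-undrop : ∀ {n} {H : Graph n} {f} {Q : Edge (dropWhere H f) → Set} {Q' P} {x y} →
  Walk (dropWhere H f) Q P x y → (∀ j → Q j → Q' (kept H f j)) → Walk H Q' P x y
walk-undrop {H = H} {f} w h = walk-map (λ j _ _ q jn → kept H f j , h j q , joins-kept H f j jn) (λ p → p) w

walk-drop : ∀ {n} {H : Graph n} {f} {Q Q' P} {x y} → Walk H Q P x y → (∀ i → Q i → f i ≡ false) →
  (∀ j → Q (kept H f j) → Q' j) → Walk (dropWhere H f) Q' P x y
walk-drop {H = H} {f} {Q} {Q'} w h1 h2 = walk-map keep (λ p → p) w
  where
  keep : ∀ {x y} i → _ → _ → Q i → Joins H i x y →
    Σ (Fin (length (dropWhere H f))) λ j → Q' j × Joins (dropWhere H f) j x y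
  keep i _ _ qi jn with kept-onto H f i (h1 i qi)
  ... | j , refl = j , h2 j qi , transport jn
    where
    transport : ∀ {x y} → Joins H (kept H f j) x y → Joins (dropWhere H f) j x y
    transport (fwd e) = fwd (trans (kept-lookup H f j) e)
    transport (bwd e) = bwd (trans (kept-lookup H f j) e)

-- Vertex deletion.  survivor H c j is the edge of H that becomes edge j of H - c; its
-- ends are the ends of j pushed back into H by punchIn c.
punchIn-pair : ∀ {n} → Fin (suc n) → Fin n × Fin n → Fin (suc n) × Fin (suc n)
punchIn-pair c p = punchIn c (proj₁ p) , punchIn c (proj₂ p)

survivor : ∀ {n} (H : Graph (suc n)) c → Edge (deleteVertex H c) → Edge H
survivor ((a , b) ∷ es) c j with c ≟ a | c ≟ b
survivor ((a , b) ∷ es) c zero | no p | no q = zero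
survivor ((a , b) ∷ es) c (suc j) | no p | no q = suc (survivor es c j)
... | yes _ | _ = suc (survivor es c j)
... | no _ | yes _ = suc (survivor es c j)

survivor-lookup : ∀ {n} (H : Graph (suc n)) c j →
  lookup H (survivor H c j) ≡ punchIn-pair c (lookup (deleteVertex H c) j)
survivor-lookup ((a , b) ∷ es) c j with c ≟ a | c ≟ b
survivor-lookup ((a , b) ∷ es) c zero | no p | no q = sym (cong₂ _,_ (punchIn-punchOut p) (punchIn-punchOut q))
survivor-lookup ((a , b) ∷ es) c (suc j) | no p | no q = survivor-lookup es c j
... | yes _ | _ = survivor-lookup es c j
... | no _ | yes _ = survivor-lookup es c j

survivor-onto : ∀ {n} (H : Graph (suc n)) c (i : Edge H) →
  c ≢ proj₁ (lookup H i) → c ≢ proj₂ (lookup H i) →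
  Σ (Edge (deleteVertex H c)) λ j → survivor H c j ≡ i
survivor-onto ((a , b) ∷ es) c i p₁ p₂ with c ≟ a | c ≟ b
survivor-onto ((a , b) ∷ es) c zero p₁ p₂ | no p | no q = zero , refl
survivor-onto ((a , b) ∷ es) c (suc i) p₁ p₂ | no p | no q with survivor-onto es c i p₁ p₂
... | j , e = suc j , cong suc e
survivor-onto ((a , b) ∷ es) c zero p₁ p₂ | yes p | _ = ⊥-elim (p₁ p)
survivor-onto ((a , b) ∷ es) c zero p₁ p₂ | no p | yes q = ⊥-elim (p₂ q)
survivor-onto ((a , b) ∷ es) c (suc i) p₁ p₂ | yes p | _ with survivor-onto es c i p₁ p₂
... | j , e = j , cong suc e
survivor-onto ((a , b) ∷ es) c (suc i) p₁ p₂ | no p | yes q with survivor-onto es c i p₁ p₂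
... | j , e = j , cong suc e

survivor-avoids : ∀ {n} (H : Graph (suc n)) c j → ¬ Inc H c (survivor H c j)
survivor-avoids H c j (inj₁ e) = punchInᵢ≢i c _ (sym (trans e (cong proj₁ (survivor-lookup H c j))))
survivor-avoids H c j (inj₂ e) = punchInᵢ≢i c _ (sym (trans e (cong proj₂ (survivor-lookup H c j))))

survivor-inc : ∀ {n} (H : Graph (suc n)) c j x' →
  Inc H (punchIn c x') (survivor H c j) → Inc (deleteVertex H c) x' j
survivor-inc H c j x' (inj₁ e) = inj₁ (punchIn-injective c _ _ (trans e (cong proj₁ (survivor-lookup H c j))))
survivor-inc H c j x' (inj₂ e) = inj₂ (punchIn-injective c _ _ (trans e (cong proj₂ (survivor-lookup H c j))))

joins-survivor : ∀ {n} (H : Graph (suc n)) c j {x' y'} → Joins (deleteVertex H c) j x' y' →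
  Joins H (survivor H c j) (punchIn c x') (punchIn c y')
joins-survivor H c j (fwd e) = fwd (trans (survivor-lookup H c j) (cong (punchIn-pair c) e))
joins-survivor H c j (bwd e) = bwd (trans (survivor-lookup H c j) (cong (punchIn-pair c) e))

joins-unsurvivor : ∀ {n} (H : Graph (suc n)) c i {x' y'} → Joins H i (punchIn c x') (punchIn c y') →
  Σ (Edge (deleteVertex H c)) λ j → (survivor H c j ≡ i) × Joins (deleteVertex H c) j x' y'
joins-unsurvivor H c i {x'} {y'} (fwd e) with survivor-onto H c i
  (λ q → punchInᵢ≢i c x' (sym (trans q (cong proj₁ e))))
  (λ q → punchInᵢ≢i c y' (sym (trans q (cong proj₂ e))))
... | j , refl = j , refl , fwd (punchIn-pair-injective (trans (sym (survivor-lookup H c j)) e))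
  where
  punchIn-pair-injective : ∀ {p q} → punchIn-pair c p ≡ punchIn-pair c q → p ≡ q
  punchIn-pair-injective e = cong₂ _,_ (punchIn-injective c _ _ (cong proj₁ e)) (punchIn-injective c _ _ (cong proj₂ e))
joins-unsurvivor H c i {x'} {y'} (bwd e) with joins-unsurvivor H c i {y'} {x'} (fwd e)
... | j , s , jn = j , s , joins-sym jn

walk-delete-vertex : ∀ {n} {H : Graph (suc n)} {c} {Q P} → (∀ {z} → P z → c ≢ z) →
  ∀ {x y} → Walk H Q P x y → ∀ {x' y'} → punchIn c x' ≡ x → punchIn c y' ≡ y →
  Walk (deleteVertex H c) (λ j → Q (survivor H c j)) (λ z' → P (punchIn c z')) x' y'
walk-delete-vertex {c = c} {P = P} nc (done p) {x'} {y'} refl ey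
  with refl ← punchIn-injective c x' y' (sym ey) = done p
walk-delete-vertex {H = H} {c} {Q} {P} nc (hop {y = y₁} p i q jn w) refl ey
  with c≢y₁ ← nc (walk-head w)
  with j , refl , jn' ← joins-unsurvivor H c i (subst (Joins H i _) (sym (punchIn-punchOut c≢y₁)) jn)
  = hop p j q jn' (walk-delete-vertex nc w (punchIn-punchOut c≢y₁) ey)

walk-undelete-vertex : ∀ {n} {H : Graph (suc n)} {c} {Q' P'} {x' y'} → Walk (deleteVertex H c) Q' P' x' y' →
  Walk H (λ i → Σ (Edge (deleteVertex H c)) λ j → survivor H c j ≡ i × Q' j)
         (λ z → Σ (Fin n) λ z' → punchIn c z' ≡ z × P' z') (punchIn c x') (punchIn c y')
walk-undelete-vertex (done p) = done (_ , refl , p)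
walk-undelete-vertex {H = H} {c} (hop p j q jn w) =
  hop (_ , refl , p) (survivor H c j) (j , refl , q) (joins-survivor H c j jn) (walk-undelete-vertex w)

loopless-delete-vertex : ∀ {n} (H : Graph (suc n)) c → Loopless H → Loopless (deleteVertex H c)
loopless-delete-vertex H c ll j eq =
  ll (survivor H c j) (trans (cong proj₁ (survivor-lookup H c j))
                        (trans (cong (punchIn c) eq) (sym (cong proj₂ (survivor-lookup H c j)))))

Avoiding : ∀ {n} (H : Graph n) → (Edge H → Bool) → Fin n → Fin n → Fin n → Set
Avoiding H f c = Walk H (λ i → f i ≡ false) (λ z → c ≢ z)

-- H - {flagged edges} - c is connected iff any two vertices other than c are joined by
-- an avoiding walk of H.  This is how all separator conditions of Defs are handled.
connected-from-avoiding : ∀ {n} (H : Graph (suc n)) f c →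
  (∀ x y → c ≢ x → c ≢ y → Avoiding H f c x y) → Connected (deleteVertex (dropWhere H f) c)
connected-from-avoiding H f c h x' y' =
  walk→reach (walk-weaken (λ _ _ → tt) (λ _ → tt)
    (walk-delete-vertex {H = dropWhere H f} {c = c} (λ p → p)
      (walk-drop (h (punchIn c x') (punchIn c y') (λ e → punchInᵢ≢i c x' (sym e)) (λ e → punchInᵢ≢i c y' (sym e)))
         (λ i q → q) (λ j q → q)) refl refl))

avoiding-from-connected : ∀ {n} (H : Graph (suc n)) f c → Connected (deleteVertex (dropWhere H f) c) →
  ∀ x y → c ≢ x → c ≢ y → Avoiding H f c x y
avoiding-from-connected H f c conn x y cx cy =
  subst₂ (Avoiding H f c) (punchIn-punchOut cx) (punchIn-punchOut cy)
    (walk-undrop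
      (walk-weaken (λ _ _ → tt) (λ { (z' , refl , _) q → punchInᵢ≢i c z' (sym q) })
        (walk-undelete-vertex {H = dropWhere H f} {c = c} (reach→walk (conn (punchOut cx) (punchOut cy)))))
      (λ j _ → kept-unflagged H f j))

indicator : Bool → ℕ
indicator b = if b then 1 else 0

count : ∀ k → (Fin k → Bool) → ℕ
count zero f = 0
count (suc k) f = indicator (f zero) + count k (λ i → f (suc i))

does-true : ∀ {n} {a b : Fin n} → does (a ≟ b) ≡ true → a ≡ b
does-true {a = a} {b} e with a ≟ b
... | yes p = p

does-false : ∀ {n} {a b : Fin n} → does (a ≟ b) ≡ false → a ≢ b
does-false {a = a} {b} e with a ≟ b
... | no p = p

count-mono : ∀ k (f g : Fin k → Bool) → (∀ i → f i ≡ true → g i ≡ true) → count k f ≤ count k g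
count-mono zero f g h = z≤n
count-mono (suc k) f g h with f zero in ef | g zero in eg
... | true | true = s≤s (count-mono k _ _ (λ i → h (suc i)))
... | true | false with () ← trans (sym (h zero ef)) eg
... | false | true = m≤n⇒m≤1+n (count-mono k _ _ (λ i → h (suc i)))
... | false | false = count-mono k _ _ (λ i → h (suc i))

count-∨ : ∀ k (f g : Fin k → Bool) → count k (λ i → f i ∨ g i) ≤ count k f + count k g
count-∨ zero f g = z≤n
count-∨ (suc k) f g with f zero | g zero
... | true | true =
  s≤s (≤-trans (count-∨ k _ _) (≤-trans (m≤n⇒m≤1+n ≤-refl) (≤-reflexive (sym (+-suc (count k _) (count k _))))))
... | true | false = s≤s (count-∨ k _ _)
... | false | true = ≤-trans (s≤s (count-∨ k _ _)) (≤-reflexive (sym (+-suc (count k _) (count k _))))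
... | false | false = count-∨ k _ _

count-disjoint : ∀ k (f g : Fin k → Bool) → (∀ i → f i ≡ true → g i ≡ false) →
  count k f + count k g ≤ count k (λ i → f i ∨ g i)
count-disjoint zero f g h = z≤n
count-disjoint (suc k) f g h with f zero in ef | g zero in eg
... | true | true with () ← trans (sym eg) (h zero ef)
... | true | false = s≤s (count-disjoint k _ _ (λ i → h (suc i)))
... | false | true = ≤-trans (≤-reflexive (+-suc (count k _) (count k _))) (s≤s (count-disjoint k _ _ (λ i → h (suc i))))
... | false | false = count-disjoint k _ _ (λ i → h (suc i))

count-none : ∀ k (f : Fin k → Bool) → (∀ i → f i ≡ false) → count k f ≡ 0
count-none zero f h = refl
count-none (suc k) f h with f zero | h zero
... | false | refl = count-none k _ (λ i → h (suc i))

count-all : ∀ k → count k (λ _ → true) ≡ k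
count-all zero = refl
count-all (suc k) = cong suc (count-all k)

count-single : ∀ k (a : Fin k) → count k (λ i → does (i ≟ a)) ≡ 1
count-single (suc k) zero = cong suc (count-none k _ (λ i → dec-false (suc i ≟ zero) λ ()))
count-single (suc k) (suc a) = trans (cong (indicator (does (zero ≟ suc a)) +_) (count-single k a))
                                     (cong (λ b → indicator b + 1) (dec-false (zero ≟ suc a) λ ()))

isIn : ∀ {k} → Fin k → List (Fin k) → Bool
isIn i [] = false
isIn i (s ∷ S) = does (i ≟ s) ∨ isIn i S

isIn-false : ∀ {k} {i : Fin k} S → isIn i S ≡ false → All (i ≢_) S
isIn-false [] _ = []
isIn-false {i = i} (s ∷ S) e = does-false (∨-conicalˡ _ _ e) ∷ isIn-false S (∨-conicalʳ (does (i ≟ s)) _ e)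

isIn-fresh : ∀ {k} {i : Fin k} S → All (i ≢_) S → isIn i S ≡ false
isIn-fresh [] [] = refl
isIn-fresh {i = i} (s ∷ S) (is ∷ iS) rewrite dec-false (i ≟ s) is = isIn-fresh S iS

isIn-true : ∀ {k} {P : Fin k → Set} {i} S → All P S → isIn i S ≡ true → P i
isIn-true {i = i} (s ∷ S) (ps ∷ pS) e with i ≟ s
... | yes refl = ps
... | no _ = isIn-true S pS e

count-isIn≤ : ∀ k (S : List (Fin k)) → count k (λ i → isIn i S) ≤ length S
count-isIn≤ k [] = ≤-reflexive (count-none k _ (λ i → refl))
count-isIn≤ k (s ∷ S) =
  ≤-trans (count-∨ k _ _) (≤-trans (≤-reflexive (cong (_+ count k (λ i → isIn i S)) (count-single k s)))
                                     (s≤s (count-isIn≤ k S)))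

count-isIn≥ : ∀ k (S : List (Fin k)) → Unique S → length S ≤ count k (λ i → isIn i S)
count-isIn≥ k [] [] = z≤n
count-isIn≥ k (s ∷ S) (sS ∷ uS) =
  ≤-trans (≤-trans (s≤s (count-isIn≥ k S uS))
                   (≤-reflexive (cong (_+ count k (λ i → isIn i S)) (sym (count-single k s)))))
          (count-disjoint k _ _ (λ i e → subst (λ t → isIn t S ≡ false) (sym (does-true e)) (isIn-fresh S sS)))

count-escape : ∀ k (f : Fin k → Bool) (S : List (Fin k)) → length S < count k f →
  Σ (Fin k) λ i → f i ≡ true × All (i ≢_) S
count-escape k f S lt with any? (λ i → decide (f i) (isIn i S))
  where
  decide : ∀ a b → Dec (a ≡ true × b ≡ false)
  decide true false = yes (refl , refl)
  decide true true = no λ { (_ , ()) }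
  decide false b = no λ { (() , _) }
... | yes (i , fi , iS) = i , fi , isIn-false S iS
... | no none = ⊥-elim (<⇒≱ lt (≤-trans (count-mono k f _ inS) (count-isIn≤ k S)))
  where
  inS : ∀ i → f i ≡ true → isIn i S ≡ true
  inS i fi with isIn i S in e
  ... | true = refl
  ... | false = ⊥-elim (none (i , fi , e))

count-lower : ∀ k (f : Fin k → Bool) (S : List (Fin k)) → Unique S → All (λ i → f i ≡ true) S →
  length S ≤ count k f
count-lower k f S uS fS = ≤-trans (count-isIn≥ k S uS) (count-mono k _ f (λ i → isIn-true S fS))

unique-length≤ : ∀ {N} (S : List (Fin N)) → Unique S → length S ≤ N
unique-length≤ {N} S uS = subst (length S ≤_) (count-all N) (count-lower N (λ _ → true) S uS (trueAll S))
  where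
  trueAll : ∀ (S : List (Fin N)) → All (λ _ → true ≡ true) S
  trueAll [] = []
  trueAll (_ ∷ S) = refl ∷ trueAll S

fresh : ∀ {N} (S : List (Fin N)) → length S < N → Σ (Fin N) λ r → All (r ≢_) S
fresh {N} S lt with count-escape N (λ _ → true) S (subst (length S <_) (sym (count-all N)) lt)
... | r , _ , rS = r , rS

third : (k l a b : Fin 3) → k ≢ l → a ≢ k → a ≢ l → b ≢ k → b ≢ l → a ≡ b
third k l a b kl ak al bk bl with a ≟ b
... | yes ab = ab
... | no ab with s≤s (s≤s (s≤s ())) ← unique-length≤ (k ∷ l ∷ a ∷ b ∷ [])
      ((kl ∷ (ak ∘ sym) ∷ (bk ∘ sym) ∷ []) ∷ ((al ∘ sym) ∷ (bl ∘ sym) ∷ []) ∷ (ab ∷ []) ∷ [] ∷ [])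

incident : ∀ {n} → Fin n → Fin n × Fin n → Bool
incident x p = does (x ≟ proj₁ p) ∨ does (x ≟ proj₂ p)

deg-count : ∀ {n} (H : Graph n) x → deg H x ≡ count (length H) (λ i → incident x (lookup H i))
deg-count [] x = refl
deg-count ((a , b) ∷ es) x = cong (indicator (incident x (a , b)) +_) (deg-count es x)

inc→incident : ∀ {n} {H : Graph n} {x i} → Inc H x i → incident x (lookup H i) ≡ true
inc→incident {H = H} {x} {i} (inj₁ e) rewrite dec-true (x ≟ proj₁ (lookup H i)) e = refl
inc→incident {H = H} {x} {i} (inj₂ e) rewrite dec-true (x ≟ proj₂ (lookup H i)) e with does (x ≟ proj₁ (lookup H i))
... | true = refl
... | false = refl

incident→inc : ∀ {n} {H : Graph n} {x i} → incident x (lookup H i) ≡ true → Inc H x i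
incident→inc {H = H} {x} {i} e with x ≟ proj₁ (lookup H i) | x ≟ proj₂ (lookup H i)
... | yes p | _ = inj₁ p
... | no _ | yes q = inj₂ q

inc-escape : ∀ {n} (H : Graph n) x (S : List (Edge H)) → length S < deg H x →
  Σ (Edge H) λ i → Inc H x i × All (i ≢_) S
inc-escape H x S lt with count-escape (length H) _ S (subst (length S <_) (deg-count H x) lt)
... | i , xi , iS = i , incident→inc {H = H} xi , iS

deg-lower : ∀ {n} (H : Graph n) x (S : List (Edge H)) → Unique S → All (Inc H x) S → length S ≤ deg H x
deg-lower H x S uS xS =
  subst (length S ≤_) (sym (deg-count H x)) (count-lower (length H) _ S uS (All.map (inc→incident {H = H}) xS))

4≰3 : ¬ (4 ≤ 3)
4≰3 (s≤s (s≤s (s≤s ())))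

≥4⇒≢3 : ∀ {d} → 4 ≤ d → d ≢ 3
≥4⇒≢3 le refl = 4≰3 le

deg3-edges : ∀ {n} (H : Graph n) x → deg H x ≡ 3 → ∀ {a b c} → a ≢ b → a ≢ c → b ≢ c →
  Inc H x a → Inc H x b → Inc H x c → ∀ i → Inc H x i → i ≡ a ⊎ i ≡ b ⊎ i ≡ c
deg3-edges H x d {a} {b} {c} ab ac bc xa xb xc i xi with i ≟ a | i ≟ b | i ≟ c
... | yes e | _ | _ = inj₁ e
... | no _ | yes e | _ = inj₂ (inj₁ e)
... | no _ | no _ | yes e = inj₂ (inj₂ e)
... | no ia | no ib | no ic = ⊥-elim (4≰3 (subst (4 ≤_) d
        (deg-lower H x (i ∷ a ∷ b ∷ c ∷ [])
          ((ia ∷ ib ∷ ic ∷ []) ∷ (ab ∷ ac ∷ []) ∷ (bc ∷ []) ∷ [] ∷ []) (xi ∷ xa ∷ xb ∷ xc ∷ []))))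

deg3-other-edges : ∀ {n} (H : Graph n) x → deg H x ≡ 3 → ∀ {e} → Inc H x e →
  Σ (Edge H) λ g → Σ (Edge H) λ h → (g ≢ e) × (h ≢ e) × (g ≢ h) × Inc H x g × Inc H x h
deg3-other-edges H x d {e} xe
  with g , xg , (ge ∷ []) ← inc-escape H x (e ∷ []) (subst (1 <_) (sym d) (s≤s (s≤s z≤n)))
  with h , xh , (he ∷ hg ∷ []) ← inc-escape H x (e ∷ g ∷ []) (subst (2 <_) (sym d) (s≤s (s≤s (s≤s z≤n))))
  = g , h , ge , he , hg ∘ sym , xg , xh

-- Deleting an edge e at a vertex x of degree 3 leaves x with two edges g and h.  With c
-- the other end of g, the vertex x is isolated in K - e - h - c, so K - e has a
-- vertex-edge-separator and, unless it is a triangle, is not 2.5-connected.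
deg3-edge-deletion-separates : ∀ {m} (K : Graph (suc (suc (suc m)))) → Loopless K →
  ∀ x (e : Edge K) → Inc K x e → deg K x ≡ 3 →
  ¬ IsTriangle (deleteEdge K e) → ¬ TwoFiveConnected (deleteEdge K e)
deg3-edge-deletion-separates {m} K ll x e xe d not-triangle (_ , no-separator)
  with g , h , ge , he , gh , xg , xh ← deg3-other-edges K x d xe
  with c , jg ← inc→joins {H = K} xg
  = no-separator not-triangle (c , h' , isolates)
  where
  K-e : Graph (suc (suc (suc m)))
  K-e = deleteEdge K e
  flag-e : Edge K → Bool
  flag-e i = does (i ≟ e)
  h-kept : Σ (Edge K-e) λ j → kept K flag-e j ≡ h
  h-kept = kept-onto K flag-e h (dec-false (h ≟ e) he)
  h' : Edge K-e
  h' = proj₁ h-kept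
  flag-h' : Edge K-e → Bool
  flag-h' i = does (i ≟ h')
  c≢x : c ≢ x
  c≢x eq = joins-distinct ll jg (sym eq)
  x' : Fin (suc (suc m))
  x' = punchOut c≢x
  -- A walk in K - e - h - c from x to another vertex starts with an edge k at x; k is
  -- one of e, g, h, but e and h are deleted and g leads to c.
  isolates : ¬ Connected (deleteVertex (deleteEdge K-e h') c)
  isolates conn with y' , (x'y' ∷ []) ← fresh (x' ∷ []) (s≤s (s≤s z≤n))
    with j , z' , _ , jn , _ ← first-step (reach→walk (conn x' y')) (x'y' ∘ sym)
    = edge-at-x (deg3-edges K x d (ge ∘ sym) (he ∘ sym) gh xe xg xh k (joins-inc₁ jnk))
    where
    j₁ : Edge (deleteEdge K-e h')
    j₁ = survivor (deleteEdge K-e h') c j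
    k₁ : Edge K-e
    k₁ = kept K-e flag-h' j₁
    k : Edge K
    k = kept K flag-e k₁
    jnk : Joins K k x (punchIn c z')
    jnk = joins-kept K flag-e k₁ (joins-kept K-e flag-h' j₁
            (subst (λ t → Joins (deleteEdge K-e h') j₁ t (punchIn c z')) (punchIn-punchOut c≢x) (joins-survivor _ c j jn)))
    edge-at-x : k ≡ e ⊎ k ≡ g ⊎ k ≡ h → ⊥
    edge-at-x (inj₁ k≡e) = does-false (kept-unflagged K flag-e k₁) k≡e
    edge-at-x (inj₂ (inj₁ refl)) = punchInᵢ≢i c z' (sym (joins-other-end ll jg jnk))
    edge-at-x (inj₂ (inj₂ k≡h)) =
      does-false (kept-unflagged K-e flag-h' j₁)
        (kept-injective K flag-e k₁ h' (trans k≡h (sym (proj₂ h-kept))))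

walk-avoids-edge : ∀ {n} (G : Graph n) (e : Edge G) b {a x y} → Inc G b e →
  Walk G (λ _ → ⊤) (λ z → z ≢ a × z ≢ b) x y → Walk G (λ i → i ≢ e) (λ z → z ≢ a) x y
walk-avoids-edge G e b {a} be = walk-map not-e proj₁
  where
  not-e : ∀ {x y} i → (x ≢ a × x ≢ b) → (y ≢ a × y ≢ b) → ⊤ → Joins G i x y →
    Σ (Edge G) λ j → j ≢ e × Joins G j x y
  not-e i (_ , xb) (_ , yb) _ jn = i , i≢e , jn
    where
    i≢e : i ≢ e
    i≢e refl with joins-ends jn be
    ... | inj₁ bx = xb (sym bx)
    ... | inj₂ by = yb (sym by)

separator-after-edge-deletion : ∀ {n} (G : Graph (suc n)) e c f →
  VertexEdgeSeparator (deleteEdge G e) c f →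
  Vertex2EdgeSeparator G c e (kept G (λ i → does (i ≟ e)) f)
separator-after-edge-deletion G e c f sep conn = sep
  (connected-from-avoiding (deleteEdge G e) (λ j → does (j ≟ f)) c λ x y cx cy →
    walk-drop (avoiding-from-connected G flag-e-f' c conn x y cx cy)
      (λ i q → ∨-conicalˡ _ _ q)
      (λ j q → dec-false (j ≟ f) λ { refl →
         does-false {a = kept G flag-e j} (∨-conicalʳ (does (kept G flag-e j ≟ e)) _ q) refl }))
  where
  flag-e : Edge G → Bool
  flag-e i = does (i ≟ e)
  flag-e-f' : Edge G → Bool
  flag-e-f' i = does (i ≟ e) ∨ does (i ≟ kept G flag-e f)

module ThreeConnectedGraph {n} (G : Graph (suc n)) (ll : Loopless G) (tc : ThreeConnected G) where

  avoiding-two : ∀ a b x y → x ≢ a → x ≢ b → y ≢ a → y ≢ b → Walk G (λ _ → ⊤) (λ z → z ≢ a × z ≢ b) x y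
  avoiding-two a b x y xa xb ya yb = reach→walk (proj₂ (proj₂ tc) a b x y xa xb ya yb)

  not-triangle : ¬ IsTriangle G
  not-triangle (n≡3 , _) = 4≰3 (subst (4 ≤_) n≡3 (proj₁ tc))

  -- Any two distinct vertices x, y are joined by a walk avoiding a third vertex w and an
  -- edge e: avoid w and an end of e not in {x,y}; if both ends of e lie in {x,y},
  -- route through a fourth vertex r instead.
  avoiding-vertex-edge : (e : Edge G) → ∀ x y w → x ≢ y → y ≢ w → x ≢ w →
    Walk G (λ i → i ≢ e) (λ z → z ≢ w) x y
  avoiding-vertex-edge e x y w xy yw xw
    with r , (rx ∷ ry ∷ rw ∷ []) ← fresh (x ∷ y ∷ w ∷ []) (proj₁ tc)
    = by-ends (p ≟ x) (p ≟ y) (q ≟ x) (q ≟ y)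
    where
    p q : Fin (suc n)
    p = proj₁ (lookup G e)
    q = proj₂ (lookup G e)
    via-r : Inc G x e → Inc G y e → Walk G (λ i → i ≢ e) (λ z → z ≢ w) x y
    via-r xe ye = walk-cat (walk-avoids-edge G e y ye (avoiding-two w y x r xw xy rw ry))
                           (walk-avoids-edge G e x xe (avoiding-two w x r y rw rx yw (xy ∘ sym)))
    by-ends : Dec (p ≡ x) → Dec (p ≡ y) → Dec (q ≡ x) → Dec (q ≡ y) → Walk G (λ i → i ≢ e) (λ z → z ≢ w) x y
    by-ends (no px) (no py) _ _ = walk-avoids-edge G e p (inj₁ refl) (avoiding-two w p x y xw (px ∘ sym) yw (py ∘ sym))
    by-ends _ _ (no qx) (no qy) = walk-avoids-edge G e q (inj₂ refl) (avoiding-two w q x y xw (qx ∘ sym) yw (qy ∘ sym))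
    by-ends (yes px) _ _ (yes qy) = via-r (inj₁ (sym px)) (inj₂ (sym qy))
    by-ends _ (yes py) (yes qx) _ = via-r (inj₂ (sym qx)) (inj₁ (sym py))
    by-ends (yes px) _ (yes qx) _ = ⊥-elim (ll e (trans px (sym qx)))
    by-ends _ (yes py) _ (yes qy) = ⊥-elim (ll e (trans py (sym qy)))

  biconnected-minus-edge : (e : Edge G) → Biconnected (deleteEdge G e)
  biconnected-minus-edge e = connected , avoiding
    where
    avoiding : (x y w : Fin (suc n)) → x ≢ y → y ≢ w → x ≢ w → Reach (deleteEdge G e) (λ z → z ≢ w) x y
    avoiding x y w xy yw xw = walk→reach (walk-drop {Q' = λ _ → ⊤} (avoiding-vertex-edge e x y w xy yw xw)
                                           (λ i i≢e → dec-false (i ≟ e) i≢e) (λ _ _ → tt))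
    connected : Connected (deleteEdge G e)
    connected x y with x ≟ y
    ... | yes refl = stop tt
    ... | no xy with w , (wx ∷ wy ∷ []) ← fresh (x ∷ y ∷ []) (≤-trans (s≤s (s≤s (s≤s z≤n))) (proj₁ tc)) =
      walk→reach (walk-weaken (λ _ _ → tt) (λ _ → tt) (reach→walk (avoiding x y w xy (wy ∘ sym) (wx ∘ sym))))

  -- If G is moreover degenerate, every edge e has an end of degree 3: otherwise G - e
  -- is still 2.5-connected, because a separator (c,f) of G - e would give a
  -- vertex-2-edge-separator (c,e,f) of G, degenerate and hence with e at a degree-3 vertex.
  edge-has-degree3-end : Degenerate G → (e : Edge G) → Σ (Fin (suc n)) λ x → Inc G x e × deg G x ≡ 3
  edge-has-degree3-end dg e with deg G (proj₁ (lookup G e)) ℕ.≟ 3 | deg G (proj₂ (lookup G e)) ℕ.≟ 3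
  ... | yes d | _ = _ , inj₁ refl , d
  ... | no _ | yes d = _ , inj₂ refl , d
  ... | no d₁ | no d₂ =
    ⊥-elim (proj₂ (proj₁ dg) e (biconnected-minus-edge e , λ _ (c , f , sep) → no-separator c f sep))
    where
    no-separator : ∀ c f → ¬ VertexEdgeSeparator (deleteEdge G e) c f
    no-separator c f sep with proj₂ dg c e _ (separator-after-edge-deletion G e c f sep)
    ... | _ , _ , d3 , _ , _ , _ , inj₁ refl , _ = d₁ d3
    ... | _ , _ , d3 , _ , _ , _ , inj₂ refl , _ = d₂ d3

common : ∀ {n} → Fin n → Fin n → Fin n × Fin n → Bool
common c x p = incident c p ∧ incident x p

incident-punchIn : ∀ {n} (c : Fin (suc n)) x' {a b} (p : c ≢ a) (q : c ≢ b) →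
  incident (punchIn c x') (a , b) ≡ incident x' (punchOut p , punchOut q)
incident-punchIn c x' p q = cong₂ _∨_ (same-test p) (same-test q)
  where
  same-test : ∀ {a} (p : c ≢ a) → does (punchIn c x' ≟ a) ≡ does (x' ≟ punchOut p)
  same-test {a} p with punchIn c x' ≟ a | x' ≟ punchOut p
  ... | yes e | no ne = ⊥-elim (ne (punchIn-injective c _ _ (trans e (sym (punchIn-punchOut p)))))
  ... | no ne | yes e = ⊥-elim (ne (trans (cong (punchIn c) e) (punchIn-punchOut p)))
  ... | yes _ | yes _ = refl
  ... | no _ | no _ = refl

-- An edge at c contributes to both sides of the degree equation below.
count-on-both-sides : ∀ i d {D k} → D ≡ d + k → i + D ≡ d + (i + k)
count-on-both-sides i d eq = trans (cong (i +_) eq) (x∙yz≈y∙xz i d _)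

deg-delete-vertex : ∀ {n} (H : Graph (suc n)) c x' →
  deg H (punchIn c x') ≡ deg (deleteVertex H c) x' + count (length H) (λ i → common c (punchIn c x') (lookup H i))
deg-delete-vertex [] c x' = refl
deg-delete-vertex ((a , b) ∷ es) c x' with c ≟ a | c ≟ b | deg-delete-vertex es c x'
... | no p | no q | ih =
  trans (cong₂ _+_ (cong indicator (incident-punchIn c x' p q)) ih)
        (sym (+-assoc (indicator (incident x' (punchOut p , punchOut q))) (deg (deleteVertex es c) x') _))
... | yes _ | _ | ih = count-on-both-sides (indicator (incident (punchIn c x') (a , b))) (deg (deleteVertex es c) x') ih
... | no _ | yes _ | ih = count-on-both-sides (indicator (incident (punchIn c x') (a , b))) (deg (deleteVertex es c) x') ih

-- For a negative goal, finitely many double negations may be eliminated together.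
¬¬-all-Fin3 : {C : Fin 3 → Set} → (∀ k → ¬ ¬ C k) → ¬ ¬ (∀ k → C k)
¬¬-all-Fin3 h not-all = h zero λ c₀ → h (suc zero) λ c₁ → h (suc (suc zero)) λ c₂ →
  not-all λ { zero → c₀ ; (suc zero) → c₁ ; (suc (suc zero)) → c₂ }

module AroundU {m} (G : Graph (suc (suc (suc (suc m))))) (ll : Loopless G) (dg : Degenerate G)
  (tc : ThreeConnected G) (u : Fin (suc (suc (suc (suc m))))) (du : deg G u ≡ 3)
  (vs : Fin 3 → Fin (suc (suc (suc (suc m))))) (fs : Fin 3 → Edge G)
  (jn : ∀ k → Joins G (fs k) u (vs k)) (vs-injective : ∀ k l → k ≢ l → vs k ≢ vs l) where

  open ThreeConnectedGraph G ll tc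

  V : Set
  V = Fin (suc (suc (suc (suc m))))

  u≢vs : ∀ k → u ≢ vs k
  u≢vs k = joins-distinct ll (jn k)

  u≢punchIn : ∀ x' → u ≢ punchIn u x'
  u≢punchIn x' = punchInᵢ≢i u x' ∘ sym

  neighbours-distinct : Unique (vs zero ∷ vs (suc zero) ∷ vs (suc (suc zero)) ∷ [])
  neighbours-distinct = (vs-injective _ _ (λ ()) ∷ vs-injective _ _ (λ ()) ∷ []) ∷ (vs-injective _ _ (λ ()) ∷ []) ∷ [] ∷ []

  vs-injective-≡ : ∀ {k l} → vs k ≡ vs l → k ≡ l
  vs-injective-≡ {k} {l} e with k ≟ l
  ... | yes kl = kl
  ... | no kl = ⊥-elim (vs-injective k l kl e)

  fs-injective : ∀ k l → k ≢ l → fs k ≢ fs l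
  fs-injective k l kl = distinct-edges ll (jn k) (jn l) (vs-injective k l kl)

  edge-at-u : ∀ i → Inc G u i → Σ (Fin 3) λ l → i ≡ fs l
  edge-at-u i ui
    with deg3-edges G u du (fs-injective zero (suc zero) (λ ())) (fs-injective zero (suc (suc zero)) (λ ()))
                           (fs-injective (suc zero) (suc (suc zero)) (λ ()))
                           (joins-inc₁ (jn zero)) (joins-inc₁ (jn (suc zero))) (joins-inc₁ (jn (suc (suc zero)))) i ui
  ... | inj₁ e = zero , e
  ... | inj₂ (inj₁ e) = suc zero , e
  ... | inj₂ (inj₂ e) = suc (suc zero) , e

  edge-from-u : ∀ {x i} → Inc G u i → Inc G x i → u ≢ x → Σ (Fin 3) λ l → i ≡ fs l × x ≡ vs l
  edge-from-u {x} {i} ui xi ux with edge-at-u i ui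
  ... | l , refl with joins-ends (jn l) xi
  ... | inj₁ e = ⊥-elim (ux (sym e))
  ... | inj₂ e = l , refl , e

  neighbour-of-u : ∀ {i z} → Joins G i u z → Σ (Fin 3) λ l → i ≡ fs l × z ≡ vs l
  neighbour-of-u j = edge-from-u (joins-inc₁ j) (joins-inc₂ j) (joins-distinct ll j)

  shared : V → ℕ
  shared x = count (length G) (λ i → common u x (lookup G i))

  shared-neighbour : ∀ k → shared (vs k) ≡ 1
  shared-neighbour k = ≤-antisym
    (≤-trans (count-mono _ _ (λ i → does (i ≟ fs k)) only-fk) (≤-reflexive (count-single _ (fs k))))
    (≤-trans (≤-reflexive (sym (count-single _ (fs k)))) (count-mono _ (λ i → does (i ≟ fs k)) _ fk-shared))
    where
    only-fk : ∀ i → common u (vs k) (lookup G i) ≡ true → does (i ≟ fs k) ≡ true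
    only-fk i t with incident u (lookup G i) in a | incident (vs k) (lookup G i) in b
    only-fk i refl | true | true with edge-from-u (incident→inc {H = G} a) (incident→inc {H = G} b) (u≢vs k)
    ... | l , il , vl with k ≟ l
    ... | yes refl = dec-true (i ≟ fs k) il
    ... | no kl = ⊥-elim (vs-injective k l kl vl)
    fk-shared : ∀ i → does (i ≟ fs k) ≡ true → common u (vs k) (lookup G i) ≡ true
    fk-shared i t with refl ← does-true {a = i} t
      rewrite inc→incident {H = G} (joins-inc₁ (jn k)) | inc→incident {H = G} (joins-inc₂ (jn k)) = refl

  shared-other : ∀ {x} → u ≢ x → (∀ k → x ≢ vs k) → shared x ≡ 0
  shared-other {x} ux xvs = count-none _ _ not-shared
    where
    not-shared : ∀ i → common u x (lookup G i) ≡ false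
    not-shared i with incident u (lookup G i) in a | incident x (lookup G i) in b
    ... | false | _ = refl
    ... | true | false = refl
    ... | true | true with edge-from-u (incident→inc {H = G} a) (incident→inc {H = G} b) ux
    ... | l , _ , xl = ⊥-elim (xvs l xl)

  deg3≢vs : ∀ {x} → deg G x ≡ 3 → ∀ k → 4 ≤ deg G (vs k) → x ≢ vs k
  deg3≢vs dx k d4 refl = ≥4⇒≢3 d4 dx

  another-neighbour : ∀ c k → Σ (Fin 3) λ l → l ≢ k × c ≢ vs l
  another-neighbour c k with any? (λ a → c ≟ vs a)
  ... | yes (a , refl) with l , (lk ∷ la ∷ []) ← fresh (k ∷ a ∷ []) ≤-refl = l , lk , vs-injective l a la ∘ sym
  ... | no none with l , (lk ∷ []) ← fresh (k ∷ []) (s≤s (s≤s z≤n)) = l , lk , λ e → none (l , e)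

  Small : Set
  Small = suc (suc (suc m)) ≡ 3

  no-five-distinct : Small → (S : List V) → Unique S → length S ≡ 5 → ⊥
  no-five-distinct refl S uS len5 with s≤s (s≤s (s≤s (s≤s ()))) ← subst (_≤ 4) len5 (unique-length≤ S uS)

  only-neighbours : Small → ∀ y → y ≢ u → Σ (Fin 3) λ k → y ≡ vs k
  only-neighbours small y yu with any? (λ k → y ≟ vs k)
  ... | yes found = found
  ... | no none = ⊥-elim (no-five-distinct small (y ∷ u ∷ vs zero ∷ vs (suc zero) ∷ vs (suc (suc zero)) ∷ [])
      ((yu ∷ y≢ zero ∷ y≢ (suc zero) ∷ y≢ (suc (suc zero)) ∷ []) ∷ (u≢vs zero ∷ u≢vs (suc zero) ∷ u≢vs (suc (suc zero)) ∷ [])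
        ∷ neighbours-distinct) refl)
    where
    y≢ : ∀ k → y ≢ vs k
    y≢ k e = none (k , e)

  -- G' arises from a supergraph H₀ of G (G itself, or G + v₁v₂) by deleting u; lift
  -- embeds the edges of G into H₀ preserving their ends.
  module Supergraph (H₀ : Graph (suc (suc (suc (suc m))))) (lift : Edge G → Edge H₀)
    (lift-lookup : ∀ i → lookup H₀ (lift i) ≡ lookup G i) (lift-injective : ∀ i j → lift i ≡ lift j → i ≡ j)
    (llH₀ : Loopless H₀) where

    G' : Graph (suc (suc (suc m)))
    G' = deleteVertex H₀ u

    loopless-G' : Loopless G'
    loopless-G' = loopless-delete-vertex H₀ u llH₀

    joins-lift : ∀ {i x y} → Joins G i x y → Joins H₀ (lift i) x y
    joins-lift {i} (fwd q) = fwd (trans (lift-lookup i) q)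
    joins-lift {i} (bwd q) = bwd (trans (lift-lookup i) q)

    walk-lift : ∀ {Q P x y} → Walk G Q P x y → Walk H₀ (λ k → Σ (Edge G) λ i → lift i ≡ k) P x y
    walk-lift = walk-map (λ i _ _ _ j → lift i , (i , refl) , joins-lift j) (λ p → p)

    avoiding-in-G' : ∀ b x' y' → punchIn u x' ≢ b → punchIn u y' ≢ b →
      Walk G' (λ _ → ⊤) (λ z' → punchIn u z' ≢ b) x' y'
    avoiding-in-G' b x' y' xb yb =
      walk-weaken (λ _ _ → tt) proj₂
        (walk-delete-vertex {H = H₀} {c = u} (λ p → proj₁ p ∘ sym)
          (walk-lift (avoiding-two u b _ _ (u≢punchIn x' ∘ sym) xb (u≢punchIn y' ∘ sym) yb)) refl refl)

    biconnected-G' : Biconnected G'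
    biconnected-G' = connected , avoiding
      where
      connected : Connected G'
      connected x' y' = walk→reach (walk-weaken (λ _ _ → tt) (λ _ → tt)
        (avoiding-in-G' u x' y' (u≢punchIn x' ∘ sym) (u≢punchIn y' ∘ sym)))
      avoiding : (x y w : Fin (suc (suc (suc m)))) → x ≢ y → y ≢ w → x ≢ w → Reach G' (λ z → z ≢ w) x y
      avoiding x' y' w' xy yw xw = walk→reach (walk-weaken (λ _ _ → tt) (λ p e → p (cong (punchIn u) e))
        (avoiding-in-G' (punchIn u w') x' y' (xw ∘ punchIn-injective u _ _) (yw ∘ punchIn-injective u _ _)))

    Detour : V → Edge H₀ → V → V → Set
    Detour c e x y = Walk H₀ (λ k → k ≢ e) (λ z → (u ≢ z) × (c ≢ z)) x y

    connected-G'-minus : ∀ c' e' → (∀ x y → u ≢ x → punchIn u c' ≢ x → u ≢ y → punchIn u c' ≢ y →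
        Detour (punchIn u c') (survivor H₀ u e') x y) →
      Connected (deleteVertex (deleteEdge G' e') c')
    connected-G'-minus c' e' detour = connected-from-avoiding G' (λ j → does (j ≟ e')) c' λ x' y' cx cy →
      walk-weaken (λ j q → dec-false (j ≟ e') (q ∘ cong (survivor H₀ u))) (λ p e → proj₂ p (cong (punchIn u) e))
        (walk-delete-vertex {H = H₀} {c = u} proj₁
          (detour (punchIn u x') (punchIn u y') (u≢punchIn x') (cx ∘ punchIn-injective u _ _)
                  (u≢punchIn y') (cy ∘ punchIn-injective u _ _)) refl refl)

    survivor-end : ∀ {e' x} → Inc H₀ x (survivor H₀ u e') → u ≢ x
    survivor-end {e'} xe refl = survivor-avoids H₀ u e' xe

    deg3-end-critical : ∀ e' x (xe : Inc H₀ x (survivor H₀ u e')) → deg G' (punchOut (survivor-end xe)) ≡ 3 →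
      ¬ IsTriangle (deleteEdge G' e') → ¬ TwoFiveConnected (deleteEdge G' e')
    deg3-end-critical e' x xe = deg3-edge-deletion-separates G' loopless-G' _ e'
      (survivor-inc H₀ u e' _ (subst (λ t → Inc H₀ t (survivor H₀ u e')) (sym (punchIn-punchOut (survivor-end xe))) xe))

    deg-G' : ∀ x (ux : u ≢ x) →
      deg H₀ x ≡ deg G' (punchOut ux) + count (length H₀) (λ i → common u x (lookup H₀ i))
    deg-G' x ux = subst (λ t → deg H₀ t ≡ deg G' (punchOut ux) + count (length H₀) (λ i → common u t (lookup H₀ i)))
      (punchIn-punchOut ux) (deg-delete-vertex H₀ u (punchOut ux))

    module Rerouting (c : V) (u≢c : u ≢ c) (e : Edge G) (u∉e : ¬ Inc G u e) where

      Detours : Set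
      Detours = ∀ k l → c ≢ vs k → c ≢ vs l → Detour c (lift e) (vs k) (vs l)

      edge-detour : ∀ {i x y} → (u ≢ x) × (c ≢ x) → (u ≢ y) × (c ≢ y) → i ≢ e → Joins G i x y →
        Detour c (lift e) x y
      edge-detour {i} px py ie j = hop px (lift i) (ie ∘ lift-injective _ _) (joins-lift j) (done py)

      -- Given detours between the neighbours of u, every walk of G - e - c between vertices
      -- other than u is turned into a detour by replacing each passage v_k – u – v_l.
      reroute : Detours → ∀ {x y} → Walk G (λ i → i ≢ e) (λ z → c ≢ z) x y → u ≢ x → u ≢ y →
        Detour c (lift e) x y
      reroute nb (done p) ux uy = done (ux , p)
      reroute nb (hop {x} {z} p i q j w) ux uy with u ≟ z
      ... | no uz = walk-cat (edge-detour (ux , p) (uz , walk-head w) q j) (reroute nb w uz uy)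
      ... | yes refl = leave-u w uy
        where
        leave-u : ∀ {y} → Walk G (λ i → i ≢ e) (λ z → c ≢ z) u y → u ≢ y → Detour c (lift e) x y
        leave-u (done _) uy = ⊥-elim (uy refl)
        leave-u (hop p' k q' j' w') uy with neighbour-of-u (joins-sym j) | neighbour-of-u j'
        ... | l , _ , refl | l' , _ , refl = walk-cat (nb l l' p (walk-head w')) (reroute nb w' (u≢vs l') uy)

      -- Follow a walk of G - e - f_k - c, having reached x by a detour from v_k: either the
      -- walk never meets u, or it first meets u through some f_l with l ≠ k.
      follow : ∀ k {x t} → Detour c (lift e) (vs k) x →
        Walk G (λ i → (i ≢ e) × (i ≢ fs k)) (λ z → c ≢ z) x t → u ≢ x → u ≢ t →
        Detour c (lift e) (vs k) t ⊎ Σ (Fin 3) λ l → l ≢ k × Detour c (lift e) (vs k) (vs l)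
      follow k acc (done _) ux ut = inj₁ acc
      follow k acc (hop {x} {z} p i (ie , ifk) j w) ux ut with u ≟ z
      ... | no uz = follow k (walk-cat acc (edge-detour (ux , p) (uz , walk-head w) ie j)) w uz ut
      ... | yes refl with neighbour-of-u (joins-sym j)
      ... | l , refl , refl = inj₂ (l , ifk ∘ cong fs , acc)

      -- G - e - c is connected since G is 2.5-connected; G - e - f_k - c is connected
      -- when deg v_k ≠ 3, since a degenerate separator (c,e,f_k) would need a degree-3
      -- vertex at f_k and e, but u is not on e.
      minus-e-connected : ¬ ¬ Connected (deleteVertex (deleteEdge G e) c)
      minus-e-connected disconnected = proj₂ (proj₁ (proj₁ dg)) not-triangle (c , e , disconnected)

      minus-e-fk-connected : ∀ k → deg G (vs k) ≢ 3 → ¬ ¬ Connected (deleteVertex (deleteEdge2 G e (fs k)) c)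
      minus-e-fk-connected k dk disconnected
        with w , _ , d3 , _ , _ , _ , we , wfk , _ ← proj₂ dg c e (fs k) disconnected
        with joins-ends (jn k) wfk
      ... | inj₁ refl = u∉e we
      ... | inj₂ refl = dk d3

      Partner : Fin 3 → Set
      Partner k = Σ (Fin 3) λ l → l ≢ k × c ≢ vs l × Detour c (lift e) (vs k) (vs l)

      partner : ∀ k → Connected (deleteVertex (deleteEdge2 G e (fs k)) c) → c ≢ vs k → Partner k
      partner k conn ck
        with l₀ , l₀k , cl₀ ← another-neighbour c k
        with follow k (done (u≢vs k , ck))
               (walk-weaken (λ i q → does-false (∨-conicalˡ _ _ q) , does-false (∨-conicalʳ (does (i ≟ e)) _ q)) (λ p → p)
                 (avoiding-from-connected G (λ i → does (i ≟ e) ∨ does (i ≟ fs k)) c conn (vs k) (vs l₀) ck cl₀))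
               (u≢vs k) (u≢vs l₀)
      ... | inj₁ s = l₀ , l₀k , cl₀ , s
      ... | inj₂ (l , lk , s) = l , lk , proj₂ (walk-last s) , s

      -- If every neighbour ≠ c has a partner, all neighbours ≠ c are joined by detours
      -- (there are only three of them).
      detours-from-partners : (∀ k → c ≢ vs k → Partner k) → Detours
      detours-from-partners N k l ck cl with k ≟ l
      ... | yes refl = done (u≢vs k , ck)
      ... | no kl with N k ck
      ... | l' , l'k , _ , s₁ with l' ≟ l
      ... | yes refl = s₁
      ... | no l'l with N l cl
      ... | l'' , l''l , _ , s₂ with l'' ≟ k
      ... | yes refl = walk-rev s₂
      ... | no l''k = walk-cat s₁ (walk-rev (subst (λ t → Detour c (lift e) (vs l) (vs t))
                                                  (sym (third k l l' l'' kl l'k l'l l''k l''l)) s₂))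

      all-detours : Detours → Connected (deleteVertex (deleteEdge G e) c) →
        ∀ x y → u ≢ x → c ≢ x → u ≢ y → c ≢ y → Detour c (lift e) x y
      all-detours nb conn x y ux cx uy cy =
        reroute nb (walk-weaken (λ i q → does-false q) (λ p → p)
                     (avoiding-from-connected G (λ i → does (i ≟ e)) c conn x y cx cy)) ux uy

  module CaseA (d4 : ∀ k → 4 ≤ deg G (vs k)) where
    open Supergraph G (λ i → i) (λ _ → refl) (λ _ _ q → q) ll

    -- Every detour between neighbours exists, since every neighbour has a partner.
    no-separator : ∀ c' e' → ¬ VertexEdgeSeparator G' c' e'
    no-separator c' e' sep =
      minus-e-connected λ conn-e →
      ¬¬-all-Fin3 (λ k → minus-e-fk-connected k (≥4⇒≢3 (d4 k))) λ conn-efk →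
      sep (connected-G'-minus c' e' (all-detours (detours-from-partners (λ k → partner k (conn-efk k))) conn-e))
      where open Rerouting (punchIn u c') (u≢punchIn c') (survivor G u e') (survivor-avoids G u e')

    -- An edge of G' has, in G, an end x of degree 3; x is not a neighbour of u, so it keeps
    -- degree 3 in G', and u, x and the three neighbours show that G' is no triangle.
    critical : ∀ e' → ¬ TwoFiveConnected (deleteEdge G' e')
    critical e' with x , xe , dx ← edge-has-degree3-end dg (survivor G u e') =
      deg3-end-critical e' x xe deg-x not-triangle'
      where
      ux : u ≢ x
      ux = survivor-end xe
      x≢vs : ∀ k → x ≢ vs k
      x≢vs k = deg3≢vs dx k (d4 k)
      deg-x : deg G' (punchOut ux) ≡ 3
      deg-x = begin
        deg G' (punchOut ux)          ≡⟨ sym (+-identityʳ _) ⟩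
        deg G' (punchOut ux) + 0       ≡⟨ cong (deg G' (punchOut ux) +_) (sym (shared-other ux x≢vs)) ⟩
        deg G' (punchOut ux) + shared x ≡⟨ sym (deg-G' x ux) ⟩
        deg G x                        ≡⟨ dx ⟩
        3                              ∎
        where open ≡-Reasoning
      not-triangle' : ¬ IsTriangle (deleteEdge G' e')
      not-triangle' (small , _) = no-five-distinct small (x ∷ u ∷ vs zero ∷ vs (suc zero) ∷ vs (suc (suc zero)) ∷ [])
        (((ux ∘ sym) ∷ x≢vs zero ∷ x≢vs (suc zero) ∷ x≢vs (suc (suc zero)) ∷ [])
          ∷ (u≢vs zero ∷ u≢vs (suc zero) ∷ u≢vs (suc (suc zero)) ∷ []) ∷ neighbours-distinct) refl

    result : Loopless G' × Critical25 G'
    result = loopless-G' , (biconnected-G' , λ _ (c' , e' , sep) → no-separator c' e' sep) , critical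

  module CaseB (d₁ : deg G (vs zero) ≡ 3) (d₃ : 4 ≤ deg G (vs (suc (suc zero)))) where
    v₁ v₂ v₃ : V
    v₁ = vs zero
    v₂ = vs (suc zero)
    v₃ = vs (suc (suc zero))

    -- If G had only the four vertices u, v₁, v₂, v₃, then v₂ would have degree 3 and yet
    -- four distinct edges; so G has at least five vertices.  First, two neighbours of u
    -- would be adjacent: the first edge of a walk between them avoiding u and the third
    -- neighbour can only lead to the second.
    adjacent : Small → ∀ a b c → a ≢ b → a ≢ c → b ≢ c → Σ (Edge G) λ i → Joins G i (vs a) (vs b)
    adjacent small a b c ab ac bc
      with i , z , _ , ji , (zu , zc) ← first-step (avoiding-two u (vs c) (vs a) (vs b)
             (u≢vs a ∘ sym) (vs-injective a c ac) (u≢vs b ∘ sym) (vs-injective b c bc)) (vs-injective a b ab)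
      with l , refl ← only-neighbours small z zu
      = i , subst (Joins G i (vs a)) (cong vs (third a c l b ac (la ∘ sym) (zc ∘ cong vs) (ab ∘ sym) bc)) ji
      where
      la : a ≢ l
      la al = joins-distinct ll ji (cong vs al)

    module Edges (small : Small) (d : Edge G) (jd : Joins G d v₁ v₂) (g : Edge G) (jg : Joins G g v₁ v₃) where
      j₁ : Joins G (fs zero) v₁ u
      j₁ = joins-sym (jn zero)

      -- The three edges at v₁ lead to u, v₂ and v₃; so an edge at v₃ other than f₃ and g
      -- leads to v₂.
      edge-at-v₁ : ∀ i → Inc G v₁ i → i ≡ fs zero ⊎ i ≡ d ⊎ i ≡ g
      edge-at-v₁ = deg3-edges G v₁ d₁ (distinct-edges ll j₁ jd (u≢vs (suc zero)))
        (distinct-edges ll j₁ jg (u≢vs (suc (suc zero)))) (distinct-edges ll jd jg (vs-injective _ _ (λ ())))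
        (joins-inc₁ j₁) (joins-inc₁ jd) (joins-inc₁ jg)

      to-v₂ : ∀ κ → Inc G v₃ κ → κ ≢ fs (suc (suc zero)) → κ ≢ g → Joins G κ v₃ v₂
      to-v₂ κ v₃κ κf κg with y , jy ← inc→joins {H = G} v₃κ | y ≟ u
      ... | yes refl with l , refl , v₃≡ ← neighbour-of-u (joins-sym jy) = ⊥-elim (κf (cong fs (sym (vs-injective-≡ v₃≡))))
      ... | no yu with only-neighbours small y yu
      ... | suc zero , refl = jy
      ... | suc (suc zero) , refl = ⊥-elim (joins-distinct ll jy refl)
      ... | zero , refl with edge-at-v₁ κ (joins-inc₂ jy)
      ... | inj₁ refl = ⊥-elim (u≢vs (suc (suc zero)) (joins-other-end ll j₁ (joins-sym jy)))
      ... | inj₂ (inj₁ refl) = ⊥-elim (vs-injective (suc zero) (suc (suc zero)) (λ ()) (joins-other-end ll jd (joins-sym jy)))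
      ... | inj₂ (inj₂ κ≡g) = ⊥-elim (κg κ≡g)

      -- An edge v₃v₂ has an end of degree 3, which is not v₃.
      deg-v₂ : ∀ κ → Joins G κ v₃ v₂ → deg G v₂ ≡ 3
      deg-v₂ κ jκ with w , wκ , dw ← edge-has-degree3-end dg κ with joins-ends jκ wκ
      ... | inj₁ refl = ⊥-elim (≥4⇒≢3 d₃ dw)
      ... | inj₂ refl = dw

      -- v₃ has two further edges k, k' (it has degree ≥ 4); both lead to v₂, so v₂ has
      -- the four edges f₂, d, k, k'.
      impossible : ⊥
      impossible
        with k , v₃k , (kf ∷ kg ∷ []) ← inc-escape G v₃ (fs (suc (suc zero)) ∷ g ∷ []) (≤-trans (s≤s (s≤s (s≤s z≤n))) d₃)
        with k' , v₃k' , (k'f ∷ k'g ∷ k'k ∷ []) ← inc-escape G v₃ (fs (suc (suc zero)) ∷ g ∷ k ∷ []) d₃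
        = 4≰3 (subst (4 ≤_) (deg-v₂ k jk) (deg-lower G v₂ (fs (suc zero) ∷ d ∷ k ∷ k' ∷ [])
          ((distinct-edges ll j₂ (joins-sym jd) (u≢vs zero)
              ∷ distinct-edges ll j₂ (joins-sym jk) (u≢vs (suc (suc zero)))
              ∷ distinct-edges ll j₂ (joins-sym jk') (u≢vs (suc (suc zero))) ∷ [])
           ∷ (distinct-edges ll (joins-sym jd) (joins-sym jk) v₁≢v₃
              ∷ distinct-edges ll (joins-sym jd) (joins-sym jk') v₁≢v₃ ∷ [])
           ∷ ((k'k ∘ sym) ∷ []) ∷ [] ∷ [])
          (joins-inc₁ j₂ ∷ joins-inc₂ jd ∷ joins-inc₂ jk ∷ joins-inc₂ jk' ∷ [])))
        where
        j₂ : Joins G (fs (suc zero)) v₂ u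
        j₂ = joins-sym (jn (suc zero))
        v₁≢v₃ : v₁ ≢ v₃
        v₁≢v₃ = vs-injective zero (suc (suc zero)) (λ ())
        jk : Joins G k v₃ v₂
        jk = to-v₂ k v₃k kf kg
        jk' : Joins G k' v₃ v₂
        jk' = to-v₂ k' v₃k' k'f k'g

    not-small : ¬ Small
    not-small small with d , jd ← adjacent small zero (suc zero) (suc (suc zero)) (λ ()) (λ ()) (λ ())
                   with g , jg ← adjacent small zero (suc (suc zero)) (suc zero) (λ ()) (λ ()) (λ ())
                   = Edges.impossible small d jd g jg

    H₀ : Graph (suc (suc (suc (suc m))))
    H₀ = (v₁ , v₂) ∷ G

    loopless-H₀ : Loopless H₀
    loopless-H₀ zero = vs-injective zero (suc zero) (λ ())
    loopless-H₀ (suc i) = ll i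

    open Supergraph H₀ suc (λ _ → refl) (λ _ _ → suc-injective) loopless-H₀

    -- If e' is the new edge, G - u - c is connected anyway.
    -- Otherwise e' comes from an edge e of G: the new edge is a detour between v₁ and v₂,
    -- and v₃ (degree ≥ 4) has a partner among them.
    no-separator : ∀ c' e' → ¬ VertexEdgeSeparator G' c' e'
    no-separator c' e' sep with survivor H₀ u e' in eq
    ... | zero = sep (connected-G'-minus c' e' old-edges)
      where
      c : V
      c = punchIn u c'
      old-edges : ∀ x y → u ≢ x → c ≢ x → u ≢ y → c ≢ y → Detour c (survivor H₀ u e') x y
      old-edges x y ux cx uy cy =
        walk-map (λ i _ _ _ j → suc i , (λ q → 0≢1+n (sym (trans q eq))) , joins-lift j)
          (λ p → proj₁ p ∘ sym , proj₂ p ∘ sym) (avoiding-two u c x y (ux ∘ sym) (cx ∘ sym) (uy ∘ sym) (cy ∘ sym))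
    ... | suc e =
      minus-e-connected λ conn-e → minus-e-fk-connected (suc (suc zero)) (≥4⇒≢3 d₃) λ conn-ef₃ →
      sep (connected-G'-minus c' e' λ x y ux cx uy cy →
        walk-weaken (λ k q r → q (trans r eq)) (λ p → p) (all-detours (detours conn-ef₃) conn-e x y ux cx uy cy))
      where
      c : V
      c = punchIn u c'
      open Rerouting c (u≢punchIn c') e (λ ue → survivor-avoids H₀ u e' (subst (Inc H₀ u) (sym eq) ue))

      among-v₁v₂ : ∀ a b → a ≢ suc (suc zero) → b ≢ suc (suc zero) → c ≢ vs a → c ≢ vs b →
        Detour c (suc e) (vs a) (vs b)
      among-v₁v₂ zero zero _ _ ca _ = done (u≢vs zero , ca)
      among-v₁v₂ zero (suc zero) _ _ ca cb = hop (u≢vs zero , ca) zero (λ ()) (fwd refl) (done (u≢vs (suc zero) , cb))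
      among-v₁v₂ (suc zero) zero a2 b2 ca cb = walk-rev (among-v₁v₂ zero (suc zero) b2 a2 cb ca)
      among-v₁v₂ (suc zero) (suc zero) _ _ ca _ = done (u≢vs (suc zero) , ca)
      among-v₁v₂ (suc (suc zero)) _ a2 _ _ _ = ⊥-elim (a2 refl)
      among-v₁v₂ _ (suc (suc zero)) _ b2 _ _ = ⊥-elim (b2 refl)

      detours : Connected (deleteVertex (deleteEdge2 G e (fs (suc (suc zero)))) c) → Detours
      detours conn k l ck cl with k ≟ suc (suc zero) | l ≟ suc (suc zero)
      ... | yes refl | yes refl = done (u≢vs k , ck)
      ... | yes refl | no l2 with l' , l'2 , cl' , s ← partner k conn ck = walk-cat s (among-v₁v₂ l' l l'2 l2 cl' cl)
      ... | no k2 | yes refl with l' , l'2 , cl' , s ← partner l conn cl = walk-rev (walk-cat s (among-v₁v₂ l' k l'2 k2 cl' ck))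
      ... | no k2 | no l2 = among-v₁v₂ k l k2 l2 ck cl

    -- Each edge of G' has an end x of degree 3 in G: for the new edge take
    -- v₁, otherwise use edge-has-degree3-end.  x ≠ v₃, and x loses the edge to u exactly
    -- when it gains the new edge, so x has degree 3 in G'.
    deg3-end : ∀ e' x (xe : Inc H₀ x (survivor H₀ u e')) → deg G x ≡ 3 → ¬ TwoFiveConnected (deleteEdge G' e')
    deg3-end e' x xe dx = deg3-end-critical e' x xe deg-x (not-small ∘ proj₁)
      where
      ux : u ≢ x
      ux = survivor-end xe
      x' : Fin (suc (suc (suc m)))
      x' = punchOut ux
      b : ℕ
      b = indicator (incident x (v₁ , v₂))
      shared-x : shared x ≡ b
      shared-x with x ≟ v₁ | x ≟ v₂
      ... | yes refl | _ = shared-neighbour zero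
      ... | no _ | yes refl = shared-neighbour (suc zero)
      ... | no x₀ | no x₁ = shared-other ux λ { zero → x₀ ; (suc zero) → x₁ ; (suc (suc zero)) → deg3≢vs dx _ d₃ }
      new-edge-not-at-u : common u x (v₁ , v₂) ≡ false
      new-edge-not-at-u rewrite dec-false (u ≟ v₁) (u≢vs zero) | dec-false (u ≟ v₂) (u≢vs (suc zero)) = refl
      deg-x : deg G' x' ≡ 3
      deg-x = +-cancelˡ-≡ b _ _ (begin
        b + deg G' x'                                            ≡⟨ +-comm b _ ⟩
        deg G' x' + b                                            ≡⟨ cong (deg G' x' +_) (sym shared-x) ⟩
        deg G' x' + shared x                                     ≡⟨ cong (λ t → deg G' x' + (indicator t + shared x)) (sym new-edge-not-at-u) ⟩
        deg G' x' + (indicator (common u x (v₁ , v₂)) + shared x) ≡⟨ sym (deg-G' x ux) ⟩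
        b + deg G x                                              ≡⟨ cong (b +_) dx ⟩
        b + 3                                                    ∎)
        where open ≡-Reasoning

    critical : ∀ e' → ¬ TwoFiveConnected (deleteEdge G' e')
    critical e' with survivor H₀ u e' in eq
    ... | zero = deg3-end e' v₁ (subst (Inc H₀ v₁) (sym eq) (inj₁ refl)) d₁
    ... | suc e with x , xe , dx ← edge-has-degree3-end dg e = deg3-end e' x (subst (Inc H₀ x) (sym eq) xe) dx

    result : Loopless G' × Critical25 G'
    result = loopless-G' , (biconnected-G' , λ _ (c' , e' , sep) → no-separator c' e' sep) , critical

triple : ∀ {A : Set} → A → A → A → Fin 3 → A
triple a b c zero = a
triple a b c (suc zero) = b
triple a b c (suc (suc zero)) = c

triple-all : ∀ {A : Set} {P : A → Set} {a b c} → P a → P b → P c → ∀ k → P (triple a b c k)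
triple-all pa pb pc zero = pa
triple-all pa pb pc (suc zero) = pb
triple-all pa pb pc (suc (suc zero)) = pc

triple-injective : ∀ {A : Set} {a b c : A} → a ≢ b → a ≢ c → b ≢ c →
  ∀ k l → k ≢ l → triple a b c k ≢ triple a b c l
triple-injective ab ac bc zero zero kl = ⊥-elim (kl refl)
triple-injective ab ac bc zero (suc zero) _ = ab
triple-injective ab ac bc zero (suc (suc zero)) _ = ac
triple-injective ab ac bc (suc zero) zero _ = ab ∘ sym
triple-injective ab ac bc (suc zero) (suc zero) kl = ⊥-elim (kl refl)
triple-injective ab ac bc (suc zero) (suc (suc zero)) _ = bc
triple-injective ab ac bc (suc (suc zero)) zero _ = ac ∘ sym
triple-injective ab ac bc (suc (suc zero)) (suc zero) _ = bc ∘ sym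
triple-injective ab ac bc (suc (suc zero)) (suc (suc zero)) kl = ⊥-elim (kl refl)

theorem8 : (n : ℕ) (G : Graph (suc n)) → Loopless G →
    Degenerate G → ThreeConnected G → ¬ ThreeRegular G →
    (u v₁ v₂ v₃ : Fin (suc n)) → deg G u ≡ 3 →
    Adj G u v₁ → Adj G u v₂ → Adj G u v₃ →
    v₁ ≢ v₂ → v₁ ≢ v₃ → v₂ ≢ v₃ →
    ((4 ≤ deg G v₁ → 4 ≤ deg G v₂ → 4 ≤ deg G v₃ →
        Loopless (deleteVertex G u) × Critical25 (deleteVertex G u) × n < suc n)
     × (deg G v₁ ≡ 3 → 4 ≤ deg G v₃ →
        Loopless (deleteVertex (addEdge G v₁ v₂) u)
        × Critical25 (deleteVertex (addEdge G v₁ v₂) u) × n < suc n))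
theorem8 zero _ _ _ (s≤s () , _) _ _ _ _ _ _ _ _ _ _ _ _
theorem8 (suc zero) _ _ _ (s≤s (s≤s ()) , _) _ _ _ _ _ _ _ _ _ _ _ _
theorem8 (suc (suc zero)) _ _ _ (s≤s (s≤s (s≤s ())) , _) _ _ _ _ _ _ _ _ _ _ _ _
theorem8 (suc (suc (suc m))) G ll dg tc _ u v₁ v₂ v₃ du a₁ a₂ a₃ n₁₂ n₁₃ n₂₃ =
  (λ d₁ d₂ d₃ → with-size (CaseA.result (triple-all {P = λ v → 4 ≤ deg G v} d₁ d₂ d₃))) ,
  (λ d₁ d₃ → with-size (CaseB.result d₁ d₃))
  where
  vs : Fin 3 → Fin (suc (suc (suc (suc m))))
  vs = triple v₁ v₂ v₃
  edge-to : ∀ k → Σ (Edge G) λ i → Joins G i u (vs k)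
  edge-to k = adj→joins (triple-all {P = Adj G u} a₁ a₂ a₃ k)
  open AroundU G ll dg tc u du vs (proj₁ ∘ edge-to) (proj₂ ∘ edge-to) (triple-injective n₁₂ n₁₃ n₂₃)
  with-size : ∀ {A B : Set} → A × B → A × B × suc (suc (suc m)) < suc (suc (suc (suc m)))
  with-size (a , b) = a , b , n<1+n _
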